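{- Let $(\Sigma,\mathscr R)$ be a Dedukti theory with $\hookrightarrow_{\beta\mathscr R}$ confluent and $\mathscr R$ arity-preserving. (1) If $\|A\|$ is defined, then for every term $N$, $\|A\{N/x\}\|$ is defined and $\|A\|=\|A\{N/x\}\|$. (2) If $A\hookrightarrow_{\beta\mathscr R}A'$ and $\|A\|$ is defined, then $\|A'\|$ is defined and $\|A\|=\|A'\|$. (3) If $A\equiv A'$ and both $\|A\|$ and $\|A'\|$ are defined, then $\|A\|=\|A'\|$.
   Context: Dedukti terms $x\mid c[\vec M]\mid\mathtt{TYPE}\mid\mathtt{KIND}\mid MN\mid\lambda x:A.M\mid\Pi x:A.B$ with constants of fixed arity declared in $\Sigma$ as $c[\Delta]:A$; rewrite rules $c[\vec l]\hookrightarrow r$; $\hookrightarrow_{\beta\mathscr R}$ is $\beta$ together with the closure of $\mathscr R$ under contexts and substitutions, and $\equiv$ is the equivalence it generates. A constant is type-level (written $\alpha$) if its declared type is of the form $\Pi\vec x:\vec B.\mathtt{TYPE}$; a rule is type-level if its head constant is. $\mathscr R$ is arity-preserving if every type-level rule has right-hand side in $R::=\alpha[\vec M]\mid R\,N\mid\lambda x:A.R$. The partial map $\|-\|$ into simple types $\sigma::=*\mid\sigma\to\sigma$: $\|\mathtt{TYPE}\|=*$, $\|\alpha[\vec M]\|=*$ for type-level $\alpha$, $\|\Pi x:A.B\|=\|A\|\to\|B\|$, $\|A\,N\|=\|A\|$, $\|\lambda x:A.B\|=\|B\|$, undefined on all other terms. -}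

module Defs where

open import Data.Nat using (ℕ; zero; suc; _≟_)
open import Data.Vec using (Vec; []; _∷_)
open import Data.Product using (∃; _×_; _,_)
open import Relation.Nullary using (yes; no)
open import Relation.Binary.Construct.Closure.ReflexiveTransitive using (Star)
open import Relation.Binary.Construct.Closure.Equivalence using (EqClosure)

record Arities : Set₁ where
  field
    Const : Set
    arity : Const → ℕ
open Arities public

-- Dedukti terms (de Bruijn indices; lam A M and pi A B bind index 0 in M / B)
--   x | c[M₁..Mₙ] | TYPE | KIND | M N | λ x:A. M | Π x:A. B

data Term (K : Arities) : Set where
  var  : ℕ → Term K
  con  : (c : Const K) → Vec (Term K) (arity K c) → Term K
  TYPE : Term K
  KIND : Term K
  app  : Term K → Term K → Term K
  lam  : Term K → Term K → Term K
  pi   : Term K → Term K → Term K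

-- A signature Σ declares c[Δ] : A, Δ being the types of the arity-many arguments.
record Signature (K : Arities) : Set where
  field
    ctx  : (c : Const K) → Vec (Term K) (arity K c)
    type : Const K → Term K
open Signature public

record Rule (K : Arities) : Set where
  constructor _[_]↪_
  field
    head : Const K
    lhs  : Vec (Term K) (arity K head)
    rhs  : Term K
open Rule public

data SType : Set where
  ⋆   : SType
  _⇒_ : SType → SType → SType

module Theory (K : Arities) (Sg : Signature K) (R : Rule K → Set) where

  Tm : Set
  Tm = Term K

  ext : (ℕ → ℕ) → ℕ → ℕ
  ext ρ zero    = zero
  ext ρ (suc i) = suc (ρ i)

  mutual
    rename : (ℕ → ℕ) → Tm → Tm
    rename ρ (var i)    = var (ρ i)
    rename ρ (con c ts) = con c (renameV ρ ts)
    rename ρ TYPE       = TYPE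
    rename ρ KIND       = KIND
    rename ρ (app M N)  = app (rename ρ M) (rename ρ N)
    rename ρ (lam A M)  = lam (rename ρ A) (rename (ext ρ) M)
    rename ρ (pi A B)   = pi (rename ρ A) (rename (ext ρ) B)

    renameV : ∀ {n} → (ℕ → ℕ) → Vec Tm n → Vec Tm n
    renameV ρ []       = []
    renameV ρ (t ∷ ts) = rename ρ t ∷ renameV ρ ts

  exts : (ℕ → Tm) → ℕ → Tm
  exts θ zero    = var zero
  exts θ (suc i) = rename suc (θ i)

  mutual
    subst : (ℕ → Tm) → Tm → Tm
    subst θ (var i)    = θ i
    subst θ (con c ts) = con c (substV θ ts)
    subst θ TYPE       = TYPE
    subst θ KIND       = KIND
    subst θ (app M N)  = app (subst θ M) (subst θ N)
    subst θ (lam A M)  = lam (subst θ A) (subst (exts θ) M)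
    subst θ (pi A B)   = pi (subst θ A) (subst (exts θ) B)

    substV : ∀ {n} → (ℕ → Tm) → Vec Tm n → Vec Tm n
    substV θ []       = []
    substV θ (t ∷ ts) = subst θ t ∷ substV θ ts

  -- β-contraction substitution: M{N/0}, lowering the other indices
  _•_ : Tm → (ℕ → Tm) → ℕ → Tm
  (N • θ) zero    = N
  (N • θ) (suc i) = θ i

  _[_] : Tm → Tm → Tm
  M [ N ] = subst (N • var) M

  -- A{N/x}: replace the free variable x by N (other free variables unchanged)
  at : ℕ → Tm → ℕ → Tm
  at x N i with i ≟ x
  ... | yes _ = N
  ... | no  _ = var i

  _[_≔_] : Tm → ℕ → Tm → Tm
  A [ x ≔ N ] = subst (at x N) A

  mutual
    data _↪_ : Tm → Tm → Set where
      beta  : ∀ {A M N} → app (lam A M) N ↪ (M [ N ])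
      rw    : ∀ {ρ} → R ρ → (θ : ℕ → Tm) →
              con (head ρ) (substV θ (lhs ρ)) ↪ subst θ (rhs ρ)
      conᶜ  : ∀ {c ts ts'} → ts ↪V ts' → con c ts ↪ con c ts'
      appˡ  : ∀ {M M' N} → M ↪ M' → app M N ↪ app M' N
      appʳ  : ∀ {M N N'} → N ↪ N' → app M N ↪ app M N'
      lamˡ  : ∀ {A A' M} → A ↪ A' → lam A M ↪ lam A' M
      lamʳ  : ∀ {A M M'} → M ↪ M' → lam A M ↪ lam A M'
      piˡ   : ∀ {A A' B} → A ↪ A' → pi A B ↪ pi A' B
      piʳ   : ∀ {A B B'} → B ↪ B' → pi A B ↪ pi A B'

    data _↪V_ : ∀ {n} → Vec Tm n → Vec Tm n → Set where
      here  : ∀ {n M M'} {ts : Vec Tm n} → M ↪ M' → (M ∷ ts) ↪V (M' ∷ ts)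
      there : ∀ {n M} {ts ts' : Vec Tm n} → ts ↪V ts' → (M ∷ ts) ↪V (M ∷ ts')

  _↪*_ : Tm → Tm → Set
  _↪*_ = Star _↪_

  -- ≡ : the equivalence relation generated by ↪βR
  _≃_ : Tm → Tm → Set
  _≃_ = EqClosure _↪_

  Confluent : Set
  Confluent = ∀ {A B C} → A ↪* B → A ↪* C → ∃ λ D → (B ↪* D) × (C ↪* D)

  data EndsInTYPE : Tm → Set where
    TYPE : EndsInTYPE TYPE
    pi   : ∀ {A B} → EndsInTYPE B → EndsInTYPE (pi A B)

  TypeLevel : Const K → Set
  TypeLevel c = EndsInTYPE (type Sg c)

  data RShape : Tm → Set where
    con : ∀ {α ts} → TypeLevel α → RShape (con α ts)
    app : ∀ {M N} → RShape M → RShape (app M N)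
    lam : ∀ {A M} → RShape M → RShape (lam A M)

  ArityPreserving : Set
  ArityPreserving = ∀ ρ → R ρ → TypeLevel (head ρ) → RShape (rhs ρ)

  -- graph of the partial map ‖-‖ : ‖ A ‖≡ σ  means ‖A‖ is defined and equals σ
  data ‖_‖≡_ : Tm → SType → Set where
    TYPE : ‖ TYPE ‖≡ ⋆
    con  : ∀ {α ts} → TypeLevel α → ‖ con α ts ‖≡ ⋆
    pi   : ∀ {A B σ τ} → ‖ A ‖≡ σ → ‖ B ‖≡ τ → ‖ pi A B ‖≡ (σ ⇒ τ)
    app  : ∀ {A N σ} → ‖ A ‖≡ σ → ‖ app A N ‖≡ σ
    lam  : ∀ {A B σ} → ‖ B ‖≡ σ → ‖ lam A B ‖≡ σ

-- ‖A‖ reads only the spine of A (Π-structure, heads of applications, bodies of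
-- abstractions) and stops at TYPE or a type-level constant, never at a variable;
-- hence substitution cannot affect it, and neither can a reduction outside the
-- spine. Inside the spine a β-step replaces a body B by an instance of B, and a
-- rule step at a type-level head produces, by arity preservation, an instance of
-- a term of shape R, whose ‖-‖ is *. For (3), confluence turns A ≡ A' into a
-- common reduct, along which ‖-‖ is preserved, and ‖-‖ is functional.
module Submission where

open import Defs
open import Data.Nat using (ℕ)
open import Data.Product using (_×_; _,_; ∃)
open import Relation.Binary.Core using (Rel)
open import Relation.Binary.PropositionalEquality using (_≡_; refl; cong₂)
open import Relation.Binary.Construct.Closure.ReflexiveTransitive using (Star; ε; _◅_; _◅◅_)
open import Relation.Binary.Construct.Closure.Symmetric using (fwd; bwd)
open import Relation.Binary.Construct.Closure.Equivalence using (EqClosure)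
open import Relation.Binary.Rewriting as Rewriting using ()

module _ {a ℓ} {A : Set a} {_⟶_ : Rel A ℓ} where

  confluent⇒joinable : Rewriting.Confluent _⟶_ → ∀ {M N} → EqClosure _⟶_ M N →
                       ∃ λ P → Star _⟶_ M P × Star _⟶_ N P
  confluent⇒joinable cf ε = _ , ε , ε
  confluent⇒joinable cf (fwd M⟶M' ◅ M'≃N) with confluent⇒joinable cf M'≃N
  ... | P , M'↠P , N↠P = P , M⟶M' ◅ M'↠P , N↠P
  confluent⇒joinable cf (bwd M'⟶M ◅ M'≃N) with confluent⇒joinable cf M'≃N
  ... | P , M'↠P , N↠P with cf (M'⟶M ◅ ε) M'↠P
  ...   | Q , M↠Q , P↠Q = Q , M↠Q , N↠P ◅◅ P↠Q

module Erasure (K : Arities) (Sg : Signature K) (R : Rule K → Set) where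
  open Theory K Sg R

  ‖‖-functional : ∀ {A σ τ} → ‖ A ‖≡ σ → ‖ A ‖≡ τ → σ ≡ τ
  ‖‖-functional TYPE      TYPE        = refl
  ‖‖-functional (con _)   (con _)     = refl
  ‖‖-functional (pi a b)  (pi a' b')  = cong₂ _⇒_ (‖‖-functional a a') (‖‖-functional b b')
  ‖‖-functional (app a)   (app a')    = ‖‖-functional a a'
  ‖‖-functional (lam b)   (lam b')    = ‖‖-functional b b'

  ‖‖-subst : ∀ θ {A σ} → ‖ A ‖≡ σ → ‖ subst θ A ‖≡ σ
  ‖‖-subst θ TYPE     = TYPE
  ‖‖-subst θ (con α)  = con α
  ‖‖-subst θ (pi a b) = pi (‖‖-subst θ a) (‖‖-subst (exts θ) b)
  ‖‖-subst θ (app a)  = app (‖‖-subst θ a)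
  ‖‖-subst θ (lam b)  = lam (‖‖-subst (exts θ) b)

  RShape-subst : ∀ θ {A} → RShape A → RShape (subst θ A)
  RShape-subst θ (con α) = con α
  RShape-subst θ (app s) = app (RShape-subst θ s)
  RShape-subst θ (lam s) = lam (RShape-subst (exts θ) s)

  RShape⇒‖‖≡⋆ : ∀ {A} → RShape A → ‖ A ‖≡ ⋆
  RShape⇒‖‖≡⋆ (con α) = con α
  RShape⇒‖‖≡⋆ (app s) = app (RShape⇒‖‖≡⋆ s)
  RShape⇒‖‖≡⋆ (lam s) = lam (RShape⇒‖‖≡⋆ s)

  module _ (arity-preserving : ArityPreserving) where

    ‖‖-↪ : ∀ {A A' σ} → A ↪ A' → ‖ A ‖≡ σ → ‖ A' ‖≡ σ
    ‖‖-↪ beta           (app (lam b)) = ‖‖-subst _ b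
    ‖‖-↪ (rw {ρ} r θ)   (con α)       = RShape⇒‖‖≡⋆ (RShape-subst θ (arity-preserving ρ r α))
    ‖‖-↪ (conᶜ _)       (con α)       = con α
    ‖‖-↪ (appˡ s)       (app a)       = app (‖‖-↪ s a)
    ‖‖-↪ (appʳ _)       (app a)       = app a
    ‖‖-↪ (lamˡ _)       (lam b)       = lam b
    ‖‖-↪ (lamʳ s)       (lam b)       = lam (‖‖-↪ s b)
    ‖‖-↪ (piˡ s)        (pi a b)      = pi (‖‖-↪ s a) b
    ‖‖-↪ (piʳ s)        (pi a b)      = pi a (‖‖-↪ s b)

    ‖‖-↪* : ∀ {A A' σ} → A ↪* A' → ‖ A ‖≡ σ → ‖ A' ‖≡ σ
    ‖‖-↪* ε        a = a
    ‖‖-↪* (s ◅ ss) a = ‖‖-↪* ss (‖‖-↪ s a)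

    ‖‖-≃ : Confluent → ∀ {A A' σ τ} → A ≃ A' → ‖ A ‖≡ σ → ‖ A' ‖≡ τ → σ ≡ τ
    ‖‖-≃ cf A≃A' a a' with confluent⇒joinable cf A≃A'
    ... | _ , A↠D , A'↠D = ‖‖-functional (‖‖-↪* A↠D a) (‖‖-↪* A'↠D a')

mainTheorem8 : (K : Arities) (Sg : Signature K) (R : Rule K → Set) →
    let open Theory K Sg R in
    Confluent → ArityPreserving →
      (∀ (A : Term K) (σ : SType) (x : ℕ) (N : Term K) → ‖ A ‖≡ σ → ‖ A [ x ≔ N ] ‖≡ σ)
      × (∀ (A A' : Term K) (σ : SType) → A ↪ A' → ‖ A ‖≡ σ → ‖ A' ‖≡ σ)
      × (∀ (A A' : Term K) (σ τ : SType) → A ≃ A' → ‖ A ‖≡ σ → ‖ A' ‖≡ τ → σ ≡ τ)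
mainTheorem8 K Sg R confluent arity-preserving =
    (λ _ _ _ _ → ‖‖-subst _)
  , (λ _ _ _ → ‖‖-↪ arity-preserving)
  , (λ _ _ _ _ → ‖‖-≃ arity-preserving confluent)
  where open Erasure K Sg R
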